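{- Let $n\ge1$ and $f:\mathbb Z_2^n\times\mathbb Z_2^n\to\mathbb Z_2^n$, $f(x,y)=x+y$ (bitwise XOR). Any Arthur–Merlin (AM) protocol $\Pi$ that computes $f$ has communication cost at least $2n-\log\rho(\Pi)-O(1)$, where the $O(1)$ is an absolute constant.
   Context: A rectangle in $D=\mathbb Z_2^n\times\mathbb Z_2^n$ is a set $S\times T$. An AM protocol consists of a finite probability space of random strings $r$ and, for each $r$, a protocol with error $\Pi_r=(\mathcal R_r,t_r,g_{r,A},g_{r,B})$, where $\mathcal R_r$ is a finite set of rectangles covering $D$, $t_r(x,y)\in\mathcal R_r$ is a rectangle containing $(x,y)$, and $g_{r,A}(x,R)$, $g_{r,B}(y,R)$ are functions of an input of Alice (resp. Bob) and a rectangle of $\mathcal R_r$ with values in $\mathbb Z_2^n$. The AM protocol computes $f$ if for every $(x,y)\in D$, with probability at least $2/3$ over $r$, $g_{r,A}(x,t_r(x,y))=g_{r,B}(y,t_r(x,y))=f(x,y)$. Its communication cost is $\log(\max_r|\mathcal R_r|)$. The thickness of $\Pi_r$ is the maximum over cells $(x,y)\in D$ of the number of rectangles of $\mathcal R_r$ containing $(x,y)$, and the thickness $\rho(\Pi)$ of the AM protocol is the maximum over $r$ of the thickness of $\Pi_r$.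
   Formalization: The finite probability space of random strings $r$ carries rational probabilities only. -}

module Defs where

open import Data.Nat using (ℕ; zero; suc; _+_; _*_; _⊔_; _<_)
open import Data.Bool using (Bool; true; false; _∧_; _xor_; if_then_else_)
open import Data.Bool.Properties using () renaming (_≟_ to _≟ᵇ_)
open import Data.Fin using (Fin)
open import Data.Vec using (Vec; []; _∷_; zipWith)
open import Data.Vec.Properties using (≡-dec)
open import Data.List using (List; []; _∷_; map; concatMap; foldr; allFin)
open import Data.Nat.ListAction using (sum)
open import Data.Product using (_×_; _,_)
open import Relation.Nullary using (¬_)
open import Relation.Nullary.Decidable using (⌊_⌋)
open import Relation.Binary.PropositionalEquality using (_≡_; _≢_)

-- Z_2^n as bit vectors of length n
Word : ℕ → Set
Word n = Vec Bool n

_==ʷ_ : ∀ {n} → Word n → Word n → Bool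
u ==ʷ v = ⌊ ≡-dec _≟ᵇ_ u v ⌋

xorW : ∀ {n} → Word n → Word n → Word n
xorW = zipWith _xor_

allWords : (n : ℕ) → List (Word n)
allWords zero = [] ∷ []
allWords (suc n) = concatMap (λ w → (false ∷ w) ∷ (true ∷ w) ∷ []) (allWords n)

allCells : (n : ℕ) → List (Word n × Word n)
allCells n = concatMap (λ x → map (λ y → (x , y)) (allWords n)) (allWords n)

maxL : List ℕ → ℕ
maxL = foldr _⊔_ 0

sumFin : (m : ℕ) → (Fin m → ℕ) → ℕ
sumFin m f = sum (map f (allFin m))

record Rect (n : ℕ) : Set where
  field
    S : Word n → Bool
    T : Word n → Bool

_∈ᴿ_ : ∀ {n} → Word n × Word n → Rect n → Bool
(x , y) ∈ᴿ R = Rect.S R x ∧ Rect.T R y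

-- a protocol with error Π_r = (R_r, t_r, g_{r,A}, g_{r,B});
-- R_r = {rect i | i : Fin size}, the rect i being pairwise distinct as sets,
-- so |R_r| = size.
record ProtocolWithError (n : ℕ) : Set where
  field
    size     : ℕ
    rect     : Fin size → Rect n
    distinct : ∀ i j → i ≢ j →
               ¬ (∀ x y → ((x , y) ∈ᴿ rect i) ≡ ((x , y) ∈ᴿ rect j))
    t        : Word n → Word n → Fin size
    t-mem    : ∀ x y → ((x , y) ∈ᴿ rect (t x y)) ≡ true
    gA       : Word n → Fin size → Word n
    gB       : Word n → Fin size → Word n

  cover : Word n × Word n → ℕ
  cover c = sumFin size (λ i → if c ∈ᴿ rect i then 1 else 0)

  thickness : ℕ
  thickness = maxL (map cover (allCells n))

-- AM protocol: finite probability space of random strings Fin m with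
-- (rational, here natural-number) weights, probability of r = weight r / total
record AMProtocol (n : ℕ) : Set where
  field
    m      : ℕ
    weight : Fin m → ℕ
    Π      : Fin m → ProtocolWithError n

  total : ℕ
  total = sumFin m weight

  maxSize : ℕ
  maxSize = maxL (map (λ r → ProtocolWithError.size (Π r)) (allFin m))

  ρ : ℕ
  ρ = maxL (map (λ r → ProtocolWithError.thickness (Π r)) (allFin m))

  correct : (Word n → Word n → Word n) → Fin m → Word n → Word n → Bool
  correct f r x y =
    let open ProtocolWithError (Π r)
        R = t x y
    in (gA x R ==ʷ f x y) ∧ (gB y R ==ʷ f x y)

-- Π computes f: total weight positive, and for every cell
-- Pr_r[correct] ≥ 2/3, i.e. 3 · (weight of correct r) ≥ 2 · total
record Computes {n : ℕ} (P : AMProtocol n) (f : Word n → Word n → Word n) : Set where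
  open AMProtocol P
  field
    total-pos : 0 < total
    success   : ∀ x y →
      2 * total Data.Nat.≤ 3 * sumFin m (λ r → if correct f r x y then weight r else 0)

module Submission where

-- Fix one protocol with error Π_r. For a rectangle R_i = S × T, let load(i)
-- be the number of correctly answered cells assigned to R_i. Alice's answer
-- gA(x, R_i) = x + y determines y from x, and Bob's determines x from y, so
-- load(i) ≤ |S| and load(i) ≤ |T|, whence load(i)² ≤ |S × T|. The number C
-- of correct cells is ∑ load(i), so by Cauchy–Schwarz
--   C² ≤ |R_r| · ∑ |R_i| = |R_r| · ∑_{cells} coverage ≤ |R_r| · thickness · |D|.
-- Averaging the success guarantee over the random strings gives some r with
-- C ≥ (2/3)|D|, and then |D| ≤ (9/4) |R_r| · thickness ≤ 4 · maxSize · ρ.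

open import Defs
open import Data.Nat using (ℕ; _≤_; _*_; _^_)
open import Data.Product using (∃-syntax)

open import Data.Nat using (zero; suc; _+_; _∸_; _<_; _≤?_; z≤n; >-nonZero)
open import Data.Nat.Properties
open import Data.Nat.ListAction using (sum)
open import Data.Nat.Solver using (module +-*-Solver)
open import Data.Bool using (Bool; true; false; _∧_; _xor_; if_then_else_)
open import Data.Bool.Properties using (xor-assoc; xor-same; xor-identityʳ) renaming (_≟_ to _≟ᵇ_)
open import Function using (id)
open import Data.Fin using (Fin)
import Data.Fin as Fin
open import Data.Fin.Properties using (any?)
open import Data.Vec using ([]; _∷_)
open import Data.Vec.Properties using (≡-dec)
open import Data.List using (List; []; _∷_; map; concatMap; allFin; length; _++_)
open import Data.List.Properties using (map-tabulate; length-tabulate)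
open import Data.List.Membership.Propositional using (_∈_)
open import Data.List.Membership.Propositional.Properties using (∈-allFin)
open import Data.List.Relation.Unary.Any using (here; there)
open import Data.Product using (_×_; _,_; proj₁; proj₂)
open import Data.Sum using (inj₁; inj₂)
open import Relation.Binary.Definitions using (DecidableEquality)
open import Relation.Binary.PropositionalEquality
open import Relation.Nullary using (Dec; yes; no)
open import Relation.Nullary.Decidable using (⌊_⌋; _×-dec_; isYes≗does; ⌊⌋-map′)
open import Relation.Nullary.Negation using (contradiction)
open +-*-Solver using (solve; _:+_; _:*_; _:=_; con)

-- ∑ xs f is the sum of f over the list xs; sumFin and cover from Defs are
-- instances of it, so the rules below apply to them directly.
∑ : ∀ {a} {A : Set a} → List A → (A → ℕ) → ℕ
∑ xs f = sum (map f xs)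

module _ {a} {A : Set a} where

  ∑-cong : (xs : List A) {f g : A → ℕ} → (∀ x → f x ≡ g x) → ∑ xs f ≡ ∑ xs g
  ∑-cong []       e = refl
  ∑-cong (x ∷ xs) e = cong₂ _+_ (e x) (∑-cong xs e)

  ∑-mono : (xs : List A) {f g : A → ℕ} → (∀ x → f x ≤ g x) → ∑ xs f ≤ ∑ xs g
  ∑-mono []       e = z≤n
  ∑-mono (x ∷ xs) e = +-mono-≤ (e x) (∑-mono xs e)

  ∑-+ : (xs : List A) (f g : A → ℕ) → ∑ xs (λ x → f x + g x) ≡ ∑ xs f + ∑ xs g
  ∑-+ []       f g = refl
  ∑-+ (x ∷ xs) f g = trans (cong (f x + g x +_) (∑-+ xs f g)) (solve 4
    (λ a b c d → (a :+ b) :+ (c :+ d) := (a :+ c) :+ (b :+ d)) refl (f x) (g x) (∑ xs f) (∑ xs g))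

  ∑-*ˡ : (xs : List A) (k : ℕ) (f : A → ℕ) → ∑ xs (λ x → k * f x) ≡ k * ∑ xs f
  ∑-*ˡ []       k f = sym (*-zeroʳ k)
  ∑-*ˡ (x ∷ xs) k f = trans (cong (k * f x +_) (∑-*ˡ xs k f)) (sym (*-distribˡ-+ k (f x) (∑ xs f)))

  ∑-*ʳ : (xs : List A) (k : ℕ) (f : A → ℕ) → ∑ xs (λ x → f x * k) ≡ ∑ xs f * k
  ∑-*ʳ []       k f = refl
  ∑-*ʳ (x ∷ xs) k f = trans (cong (f x * k +_) (∑-*ʳ xs k f)) (sym (*-distribʳ-+ k (f x) (∑ xs f)))

  ∑-const : (xs : List A) (c : ℕ) → ∑ xs (λ _ → c) ≡ length xs * c
  ∑-const []       c = refl
  ∑-const (x ∷ xs) c = cong (c +_) (∑-const xs c)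

  length-as-∑ : (xs : List A) → length xs ≡ ∑ xs (λ _ → 1)
  length-as-∑ xs = sym (trans (∑-const xs 1) (*-identityʳ (length xs)))

  ∑-++ : (xs ys : List A) (f : A → ℕ) → ∑ (xs ++ ys) f ≡ ∑ xs f + ∑ ys f
  ∑-++ []       ys f = refl
  ∑-++ (x ∷ xs) ys f = trans (cong (f x +_) (∑-++ xs ys f)) (sym (+-assoc (f x) _ _))

  ∑≤length*max : (xs : List A) (f : A → ℕ) → ∑ xs f ≤ length xs * maxL (map f xs)
  ∑≤length*max []       f = z≤n
  ∑≤length*max (x ∷ xs) f = +-mono-≤ (m≤m⊔n (f x) M)
    (≤-trans (∑≤length*max xs f) (*-monoʳ-≤ (length xs) (m≤n⊔m (f x) M)))
    where M = maxL (map f xs)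

  ≤-maxL : {xs : List A} (f : A → ℕ) {x : A} → x ∈ xs → f x ≤ maxL (map f xs)
  ≤-maxL f (here refl) = m≤m⊔n _ _
  ≤-maxL f (there p)   = ≤-trans (≤-maxL f p) (m≤n⊔m _ _)

module _ {a b} {A : Set a} {B : Set b} where

  ∑-swap : (xs : List A) (ys : List B) (f : A → B → ℕ) →
           ∑ xs (λ x → ∑ ys (f x)) ≡ ∑ ys (λ y → ∑ xs (λ x → f x y))
  ∑-swap []       ys f = sym (trans (∑-const ys 0) (*-zeroʳ (length ys)))
  ∑-swap (x ∷ xs) ys f = trans (cong (∑ ys (f x) +_) (∑-swap xs ys f))
    (sym (∑-+ ys (f x) (λ y → ∑ xs (λ x′ → f x′ y))))

  ∑-product : (xs : List A) (ys : List B) (f : A → ℕ) (g : B → ℕ) →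
              ∑ xs (λ x → ∑ ys (λ y → f x * g y)) ≡ ∑ xs f * ∑ ys g
  ∑-product xs ys f g = trans (∑-cong xs (λ x → ∑-*ˡ ys (f x) g)) (∑-*ʳ xs (∑ ys g) f)

  ∑-concatMap : (xs : List A) (h : A → List B) (f : B → ℕ) →
                ∑ (concatMap h xs) f ≡ ∑ xs (λ x → ∑ (h x) f)
  ∑-concatMap []       h f = refl
  ∑-concatMap (x ∷ xs) h f =
    trans (∑-++ (h x) (concatMap h xs) f) (cong (∑ (h x) f +_) (∑-concatMap xs h f))

  ∑-map : (xs : List A) (h : A → B) (f : B → ℕ) → ∑ (map h xs) f ≡ ∑ xs (λ x → f (h x))
  ∑-map []       h f = refl
  ∑-map (x ∷ xs) h f = cong (f (h x) +_) (∑-map xs h f)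

-- AM–GM for a pair x ≤ x + d, where it is the identity
-- 2x(x+d) + d² = x² + (x+d)²
2xy≤x²+y²-shifted : ∀ x d → 2 * (x * (x + d)) ≤ x * x + (x + d) * (x + d)
2xy≤x²+y²-shifted x d = subst (2 * (x * (x + d)) ≤_)
  (solve 2 (λ x d → con 2 :* (x :* (x :+ d)) :+ d :* d := x :* x :+ (x :+ d) :* (x :+ d)) refl x d)
  (m≤m+n _ (d * d))

2xy≤x²+y² : ∀ x y → 2 * (x * y) ≤ x * x + y * y
2xy≤x²+y² x y with ≤-total x y
... | inj₁ x≤y = subst (λ z → 2 * (x * z) ≤ x * x + z * z) (m+[n∸m]≡n x≤y) (2xy≤x²+y²-shifted x (y ∸ x))
... | inj₂ y≤x = subst (λ z → 2 * (z * y) ≤ z * z + y * y) (m+[n∸m]≡n y≤x)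
  (subst₂ _≤_ (cong (2 *_) (*-comm y z)) (+-comm (y * y) (z * z)) (2xy≤x²+y²-shifted y (x ∸ y)))
  where z = y + (x ∸ y)

-- Cauchy–Schwarz (∑ f)² ≤ |xs| · ∑ f², via
-- 2 ∑ₓ∑ᵧ f x f y ≤ ∑ₓ∑ᵧ (f x² + f y²) = 2 |xs| ∑ f²
cauchy-schwarz : ∀ {a} {A : Set a} (xs : List A) (f : A → ℕ) →
                 ∑ xs f * ∑ xs f ≤ length xs * ∑ xs (λ x → f x * f x)
cauchy-schwarz {A = A} xs f = *-cancelˡ-≤ 2 (begin
  2 * (S * S)                                               ≡⟨ cong (2 *_) (sym (∑-product xs xs f f)) ⟩
  2 * ∑ xs (λ x → ∑ xs (λ y → f x * f y))                   ≡⟨ sym (double-scale 2) ⟩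
  ∑ xs (λ x → ∑ xs (λ y → 2 * (f x * f y)))                 ≤⟨ ∑-mono xs (λ x → ∑-mono xs (λ y → 2xy≤x²+y² (f x) (f y))) ⟩
  ∑ xs (λ x → ∑ xs (λ y → sq x + sq y))                     ≡⟨ ∑-cong xs split ⟩
  ∑ xs (λ x → L * sq x + Q)                                 ≡⟨ ∑-+ xs (λ x → L * sq x) (λ _ → Q) ⟩
  ∑ xs (λ x → L * sq x) + ∑ xs (λ _ → Q)                    ≡⟨ cong₂ _+_ (∑-*ˡ xs L sq) (∑-const xs Q) ⟩
  L * Q + L * Q                                             ≡⟨ cong (L * Q +_) (sym (+-identityʳ (L * Q))) ⟩
  2 * (L * Q)                                               ∎)
  where
  open ≤-Reasoning
  sq : A → ℕ
  sq x = f x * f x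
  S L Q : ℕ
  S = ∑ xs f
  L = length xs
  Q = ∑ xs sq
  double-scale : ∀ k → ∑ xs (λ x → ∑ xs (λ y → k * (f x * f y))) ≡ k * ∑ xs (λ x → ∑ xs (λ y → f x * f y))
  double-scale k = trans (∑-cong xs (λ x → ∑-*ˡ xs k _)) (∑-*ˡ xs k _)
  split : ∀ x → ∑ xs (λ y → sq x + sq y) ≡ L * sq x + Q
  split x = trans (∑-+ xs (λ _ → sq x) sq) (cong (_+ Q) (∑-const xs (sq x)))

⟦_⟧ : Bool → ℕ
⟦ b ⟧ = if b then 1 else 0

⟦∧⟧ : ∀ a b → ⟦ a ∧ b ⟧ ≡ ⟦ a ⟧ * ⟦ b ⟧
⟦∧⟧ true  b = sym (+-identityʳ ⟦ b ⟧)
⟦∧⟧ false b = refl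

∧-true : ∀ {a b} → a ∧ b ≡ true → a ≡ true × b ≡ true
∧-true {true} e = refl , e

⟦⟧*-mono : ∀ {c d e f : Bool} → (c ≡ true → d ≡ true → e ≡ true × f ≡ true) →
           ⟦ c ⟧ * ⟦ d ⟧ ≤ ⟦ e ⟧ * ⟦ f ⟧
⟦⟧*-mono {true} {true} h with h refl refl
... | refl , refl = ≤-refl
⟦⟧*-mono {true} {false} h = z≤n
⟦⟧*-mono {false}        h = z≤n

⌊⌋-sound : ∀ {p} {P : Set p} (d : Dec P) → ⌊ d ⌋ ≡ true → P
⌊⌋-sound (yes p) _ = p

⌊⌋-complete : ∀ {p} {P : Set p} (d : Dec P) → P → ⌊ d ⌋ ≡ true
⌊⌋-complete (yes _) _ = refl
⌊⌋-complete (no ¬p) p = contradiction p ¬p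

record Enumerates {a} {A : Set a} (_≟_ : DecidableEquality A) (xs : List A) : Set a where
  constructor enumerates
  field exactly-once : ∀ w → ∑ xs (λ u → ⟦ ⌊ u ≟ w ⌋ ⟧) ≡ 1
open Enumerates

∑-point : ∀ {a} {A : Set a} {_≟_ : DecidableEquality A} {xs : List A} →
          Enumerates _≟_ xs → ∀ w c → ∑ xs (λ u → ⟦ ⌊ u ≟ w ⌋ ⟧ * c) ≡ c
∑-point {xs = xs} enum w c = trans (∑-*ʳ xs c _) (trans (cong (_* c) (exactly-once enum w)) (*-identityˡ c))

∑-allFin-suc : ∀ N (f : Fin (suc N) → ℕ) →
               ∑ (allFin (suc N)) f ≡ f Fin.zero + ∑ (allFin N) (λ i → f (Fin.suc i))
∑-allFin-suc N f = cong (λ l → f Fin.zero + sum l)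
  (trans (map-tabulate Fin.suc f) (sym (map-tabulate id (λ i → f (Fin.suc i)))))

-- the index w occurs once in allFin N; note that suc u ≟ zero is by
-- definition a no, and suc u ≟ suc w is decided by u ≟ w
allFin-once : ∀ N (w : Fin N) → ∑ (allFin N) (λ u → ⟦ ⌊ u Fin.≟ w ⌋ ⟧) ≡ 1
allFin-once (suc N) Fin.zero = begin
  ∑ (allFin (suc N)) (λ u → ⟦ ⌊ u Fin.≟ Fin.zero ⌋ ⟧) ≡⟨ ∑-allFin-suc N (λ u → ⟦ ⌊ u Fin.≟ Fin.zero ⌋ ⟧) ⟩
  1 + ∑ (allFin N) (λ _ → 0)                          ≡⟨ cong suc (∑-const (allFin N) 0) ⟩
  1 + length (allFin N) * 0                           ≡⟨ cong suc (*-zeroʳ (length (allFin N))) ⟩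
  1                                                   ∎
  where open ≡-Reasoning
allFin-once (suc N) (Fin.suc w) = begin
  ∑ (allFin (suc N)) (λ u → ⟦ ⌊ u Fin.≟ Fin.suc w ⌋ ⟧)  ≡⟨ ∑-allFin-suc N (λ u → ⟦ ⌊ u Fin.≟ Fin.suc w ⌋ ⟧) ⟩
  ∑ (allFin N) (λ u → ⟦ ⌊ Fin.suc u Fin.≟ Fin.suc w ⌋ ⟧) ≡⟨ ∑-cong (allFin N) (λ u → cong ⟦_⟧ (⌊⌋-map′ _ _ (u Fin.≟ w))) ⟩
  ∑ (allFin N) (λ u → ⟦ ⌊ u Fin.≟ w ⌋ ⟧)                ≡⟨ allFin-once N w ⟩
  1                                                      ∎
  where open ≡-Reasoning

allFin-enumerates : ∀ N → Enumerates Fin._≟_ (allFin N)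
allFin-enumerates N = enumerates (allFin-once N)

-- decidable equality of words, so that u ==ʷ v of Defs is ⌊ u ≟ʷ v ⌋
_≟ʷ_ : ∀ {n} → DecidableEquality (Word n)
_≟ʷ_ = ≡-dec _≟ᵇ_

⌊∷≟ʷ∷⌋ : ∀ {n} a b (u v : Word n) → ⌊ (a ∷ u) ≟ʷ (b ∷ v) ⌋ ≡ ⌊ a ≟ᵇ b ⌋ ∧ ⌊ u ≟ʷ v ⌋
⌊∷≟ʷ∷⌋ a b u v = trans (⌊⌋-map′ _ _ ((a ≟ᵇ b) ×-dec (u ≟ʷ v)))
  (trans (isYes≗does ((a ≟ᵇ b) ×-dec (u ≟ʷ v)))
         (sym (cong₂ _∧_ (isYes≗does (a ≟ᵇ b)) (isYes≗does (u ≟ʷ v)))))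

∑-allWords-suc : ∀ n (f : Word (suc n) → ℕ) →
                 ∑ (allWords (suc n)) f ≡ ∑ (allWords n) (λ w → f (false ∷ w) + f (true ∷ w))
∑-allWords-suc n f = trans (∑-concatMap (allWords n) _ f)
  (∑-cong (allWords n) (λ w → cong (f (false ∷ w) +_) (+-identityʳ _)))

allWords-once : ∀ n (w : Word n) → ∑ (allWords n) (λ u → ⟦ ⌊ u ≟ʷ w ⌋ ⟧) ≡ 1
allWords-once zero    [] = refl
allWords-once (suc n) (b ∷ v) = begin
  ∑ (allWords (suc n)) (λ u → ⟦ ⌊ u ≟ʷ (b ∷ v) ⌋ ⟧)  ≡⟨ ∑-allWords-suc n _ ⟩
  ∑ (allWords n) (λ u → ⟦ ⌊ (false ∷ u) ≟ʷ (b ∷ v) ⌋ ⟧ + ⟦ ⌊ (true ∷ u) ≟ʷ (b ∷ v) ⌋ ⟧)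
    ≡⟨ ∑-cong (allWords n) (λ u → trans (cong₂ (λ p q → ⟦ p ⟧ + ⟦ q ⟧) (⌊∷≟ʷ∷⌋ false b u v) (⌊∷≟ʷ∷⌋ true b u v))
                                        (one-bit-matches b ⌊ u ≟ʷ v ⌋)) ⟩
  ∑ (allWords n) (λ u → ⟦ ⌊ u ≟ʷ v ⌋ ⟧)              ≡⟨ allWords-once n v ⟩
  1                                                   ∎
  where
  open ≡-Reasoning
  one-bit-matches : ∀ b e → ⟦ ⌊ false ≟ᵇ b ⌋ ∧ e ⟧ + ⟦ ⌊ true ≟ᵇ b ⌋ ∧ e ⟧ ≡ ⟦ e ⟧
  one-bit-matches false e = +-identityʳ ⟦ e ⟧
  one-bit-matches true  e = refl

allWords-enumerates : ∀ n → Enumerates _≟ʷ_ (allWords n)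
allWords-enumerates n = enumerates (allWords-once n)

length-allWords : ∀ n → length (allWords n) ≡ 2 ^ n
length-allWords zero    = refl
length-allWords (suc n) = begin
  length (allWords (suc n))      ≡⟨ length-as-∑ (allWords (suc n)) ⟩
  ∑ (allWords (suc n)) (λ _ → 1) ≡⟨ ∑-allWords-suc n (λ _ → 1) ⟩
  ∑ (allWords n) (λ _ → 2)       ≡⟨ ∑-const (allWords n) 2 ⟩
  length (allWords n) * 2        ≡⟨ cong (_* 2) (length-allWords n) ⟩
  2 ^ n * 2                      ≡⟨ *-comm (2 ^ n) 2 ⟩
  2 ^ suc n                      ∎
  where open ≡-Reasoning

∑-cells : ∀ n (g : Word n × Word n → ℕ) →
          ∑ (allCells n) g ≡ ∑ (allWords n) (λ x → ∑ (allWords n) (λ y → g (x , y)))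
∑-cells n g = trans (∑-concatMap (allWords n) _ g)
  (∑-cong (allWords n) (λ x → ∑-map (allWords n) (x ,_) g))

length-allCells : ∀ n → length (allCells n) ≡ 2 ^ (2 * n)
length-allCells n = begin
  length (allCells n)                        ≡⟨ length-as-∑ (allCells n) ⟩
  ∑ (allCells n) (λ _ → 1)                   ≡⟨ ∑-cells n (λ _ → 1) ⟩
  ∑ (allWords n) (λ _ → ∑ (allWords n) (λ _ → 1))
    ≡⟨ ∑-cong (allWords n) (λ _ → sym (length-as-∑ (allWords n))) ⟩
  ∑ (allWords n) (λ _ → length (allWords n)) ≡⟨ ∑-const (allWords n) _ ⟩
  length (allWords n) * length (allWords n)  ≡⟨ cong₂ _*_ (length-allWords n) (length-allWords n) ⟩
  2 ^ n * 2 ^ n                              ≡⟨ sym (trans (^-distribˡ-+-* 2 n (n + 0)) (cong (λ k → 2 ^ n * 2 ^ k) (+-identityʳ n))) ⟩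
  2 ^ (2 * n)                                ∎
  where open ≡-Reasoning

xorW-cancelˡ : ∀ {n} (x y : Word n) → xorW x (xorW x y) ≡ y
xorW-cancelˡ []      []      = refl
xorW-cancelˡ (a ∷ x) (b ∷ y) =
  cong₂ _∷_ (trans (sym (xor-assoc a a b)) (cong (_xor b) (xor-same a))) (xorW-cancelˡ x y)

xorW-cancelʳ : ∀ {n} (x y : Word n) → xorW (xorW x y) y ≡ x
xorW-cancelʳ []      []      = refl
xorW-cancelʳ (a ∷ x) (b ∷ y) =
  cong₂ _∷_ (trans (xor-assoc a b b) (trans (cong (a xor_) (xor-same b)) (xor-identityʳ a))) (xorW-cancelʳ x y)

module SingleProtocol {n : ℕ} (Π : ProtocolWithError n) where
  open ProtocolWithError Π

  -- Π answers x + y on both sides at the cell (this is AMProtocol.correct xorW)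
  correctAt : Word n × Word n → Bool
  correctAt (x , y) = (gA x (t x y) ==ʷ xorW x y) ∧ (gB y (t x y) ==ʷ xorW x y)

  hit : Fin size → Word n × Word n → ℕ
  hit i (x , y) = ⟦ ⌊ i Fin.≟ t x y ⌋ ⟧ * ⟦ correctAt (x , y) ⟧

  load : Fin size → ℕ
  load i = ∑ (allCells n) (hit i)

  correctCount : ℕ
  correctCount = ∑ (allCells n) (λ c → ⟦ correctAt c ⟧)

  width height area : Fin size → ℕ
  width  i = ∑ (allWords n) (λ x → ⟦ Rect.S (rect i) x ⟧)
  height i = ∑ (allWords n) (λ y → ⟦ Rect.T (rect i) y ⟧)
  area   i = ∑ (allCells n) (λ c → ⟦ c ∈ᴿ rect i ⟧)

  answers-determine : ∀ {x y i} → i ≡ t x y → correctAt (x , y) ≡ true →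
                      y ≡ xorW x (gA x i) × x ≡ xorW (gB y i) y
  answers-determine {x} {y} refl ok with ∧-true ok
  ... | alice , bob =
    sym (trans (cong (xorW x) (⌊⌋-sound (_ ≟ʷ _) alice)) (xorW-cancelˡ x y)) ,
    sym (trans (cong (λ z → xorW z y) (⌊⌋-sound (_ ≟ʷ _) bob)) (xorW-cancelʳ x y))

  inside : ∀ {x y i} → i ≡ t x y → Rect.S (rect i) x ≡ true × Rect.T (rect i) y ≡ true
  inside {x} {y} refl = ∧-true (t-mem x y)

  hit≤row : ∀ i x y → hit i (x , y) ≤ ⟦ ⌊ y ≟ʷ xorW x (gA x i) ⌋ ⟧ * ⟦ Rect.S (rect i) x ⟧
  hit≤row i x y = ⟦⟧*-mono λ assigned ok → let i≡t = ⌊⌋-sound (i Fin.≟ t x y) assigned in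
    ⌊⌋-complete (_ ≟ʷ _) (proj₁ (answers-determine i≡t ok)) , proj₁ (inside i≡t)

  hit≤column : ∀ i x y → hit i (x , y) ≤ ⟦ ⌊ x ≟ʷ xorW (gB y i) y ⌋ ⟧ * ⟦ Rect.T (rect i) y ⟧
  hit≤column i x y = ⟦⟧*-mono λ assigned ok → let i≡t = ⌊⌋-sound (i Fin.≟ t x y) assigned in
    ⌊⌋-complete (_ ≟ʷ _) (proj₂ (answers-determine i≡t ok)) , proj₂ (inside i≡t)

  -- each row of rectangle i contains at most one correct cell assigned to it
  load≤width : ∀ i → load i ≤ width i
  load≤width i = begin
    load i                                                     ≡⟨ ∑-cells n (hit i) ⟩
    ∑ W (λ x → ∑ W (λ y → hit i (x , y)))                      ≤⟨ ∑-mono W (λ x → ∑-mono W (hit≤row i x)) ⟩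
    ∑ W (λ x → ∑ W (λ y → ⟦ ⌊ y ≟ʷ xorW x (gA x i) ⌋ ⟧ * ⟦ Rect.S (rect i) x ⟧))
      ≡⟨ ∑-cong W (λ x → ∑-point (allWords-enumerates n) _ _) ⟩
    width i                                                    ∎
    where open ≤-Reasoning
          W : List (Word n)
          W = allWords n

  -- ... and so does each column
  load≤height : ∀ i → load i ≤ height i
  load≤height i = begin
    load i                                                     ≡⟨ ∑-cells n (hit i) ⟩
    ∑ W (λ x → ∑ W (λ y → hit i (x , y)))                      ≡⟨ ∑-swap W W (λ x y → hit i (x , y)) ⟩
    ∑ W (λ y → ∑ W (λ x → hit i (x , y)))                      ≤⟨ ∑-mono W (λ y → ∑-mono W (λ x → hit≤column i x y)) ⟩
    ∑ W (λ y → ∑ W (λ x → ⟦ ⌊ x ≟ʷ xorW (gB y i) y ⌋ ⟧ * ⟦ Rect.T (rect i) y ⟧))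
      ≡⟨ ∑-cong W (λ y → ∑-point (allWords-enumerates n) _ _) ⟩
    height i                                                   ∎
    where open ≤-Reasoning
          W : List (Word n)
          W = allWords n

  load²≤area : ∀ i → load i * load i ≤ area i
  load²≤area i = begin
    load i * load i                ≤⟨ *-mono-≤ (load≤width i) (load≤height i) ⟩
    width i * height i             ≡⟨ sym (∑-product W W _ _) ⟩
    ∑ W (λ x → ∑ W (λ y → ⟦ Rect.S (rect i) x ⟧ * ⟦ Rect.T (rect i) y ⟧))
      ≡⟨ sym (trans (∑-cells n _) (∑-cong W (λ x → ∑-cong W (λ y → ⟦∧⟧ (Rect.S (rect i) x) (Rect.T (rect i) y))))) ⟩
    area i                         ∎
    where open ≤-Reasoning
          W : List (Word n)
          W = allWords n

  -- every correct cell is counted by exactly one rectangle, the one it is assigned to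
  correctCount≡∑load : correctCount ≡ ∑ (allFin size) load
  correctCount≡∑load = trans (∑-cong (allCells n) split) (∑-swap (allCells n) (allFin size) (λ c i → hit i c))
    where
    split : ∀ c → ⟦ correctAt c ⟧ ≡ ∑ (allFin size) (λ i → hit i c)
    split (x , y) = sym (∑-point (allFin-enumerates size) (t x y) ⟦ correctAt (x , y) ⟧)

  -- the areas add up to the total coverage, which the thickness bounds
  ∑area≤ : ∑ (allFin size) area ≤ length (allCells n) * thickness
  ∑area≤ = ≤-trans (≤-reflexive (sym (∑-swap (allCells n) (allFin size) (λ c i → ⟦ c ∈ᴿ rect i ⟧))))
                   (∑≤length*max (allCells n) cover)

  correctCount² : correctCount * correctCount ≤ size * thickness * length (allCells n)
  correctCount² = begin
    correctCount * correctCount                 ≡⟨ cong₂ _*_ correctCount≡∑load correctCount≡∑load ⟩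
    ∑ Rs load * ∑ Rs load                       ≤⟨ cauchy-schwarz Rs load ⟩
    length Rs * ∑ Rs (λ i → load i * load i)    ≡⟨ cong (_* ∑ Rs (λ i → load i * load i)) (length-tabulate {n = size} id) ⟩
    size * ∑ Rs (λ i → load i * load i)         ≤⟨ *-monoʳ-≤ size (∑-mono Rs load²≤area) ⟩
    size * ∑ Rs area                            ≤⟨ *-monoʳ-≤ size ∑area≤ ⟩
    size * (D * thickness)                      ≡⟨ solve 3 (λ s d θ → s :* (d :* θ) := s :* θ :* d) refl size D thickness ⟩
    size * thickness * D                        ∎
    where open ≤-Reasoning
          Rs : List (Fin size)
          Rs = allFin size
          D : ℕ
          D = length (allCells n)

averaging : ∀ m (w b : Fin m → ℕ) a → 0 < ∑ (allFin m) w →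
            a * ∑ (allFin m) w ≤ ∑ (allFin m) (λ r → w r * b r) → ∃[ r ] a ≤ b r
averaging m w b a total>0 average≥a with any? (λ r → a ≤? b r)
... | yes found = found
... | no  none  = contradiction total≤0 (<⇒≱ total>0)
  where
  open ≤-Reasoning
  Rs : List (Fin m)
  Rs = allFin m
  total≤0 : ∑ Rs w ≤ 0
  total≤0 = +-cancelʳ-≤ (∑ Rs (λ r → w r * b r)) (∑ Rs w) 0 (begin
    ∑ Rs w + ∑ Rs (λ r → w r * b r) ≡⟨ sym (∑-+ Rs w (λ r → w r * b r)) ⟩
    ∑ Rs (λ r → w r + w r * b r)    ≡⟨ ∑-cong Rs (λ r → sym (*-suc (w r) (b r))) ⟩
    ∑ Rs (λ r → w r * suc (b r))    ≤⟨ ∑-mono Rs (λ r → *-monoʳ-≤ (w r) (≰⇒> (λ a≤b → none (r , a≤b)))) ⟩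
    ∑ Rs (λ r → w r * a)            ≡⟨ trans (∑-*ʳ Rs a w) (*-comm _ a) ⟩
    a * ∑ Rs w                      ≤⟨ average≥a ⟩
    ∑ Rs (λ r → w r * b r)          ∎)

weighted-indicator : ∀ k b w → k * (if b then w else 0) ≡ w * (k * ⟦ b ⟧)
weighted-indicator k true  w = trans (*-comm k w) (cong (w *_) (sym (*-identityʳ k)))
weighted-indicator k false w = trans (*-zeroʳ k) (sym (trans (cong (w *_) (*-zeroʳ k)) (*-zeroʳ w)))

-- summing the success guarantee over all cells of D: the expected number
-- of correctly answered cells is at least 2/3 of |D|
expected-correct : ∀ {n} (P : AMProtocol n) → Computes P xorW →
  let open AMProtocol P in
  2 * length (allCells n) * total ≤ ∑ (allFin m) (λ r → weight r * (3 * SingleProtocol.correctCount (Π r)))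
expected-correct {n} P computes = begin
  2 * D * total                  ≡⟨ solve 2 (λ d τ → con 2 :* d :* τ := d :* (con 2 :* τ)) refl D total ⟩
  D * (2 * total)                ≡⟨ sym (∑-const cells (2 * total)) ⟩
  ∑ cells (λ _ → 2 * total)      ≤⟨ ∑-mono cells (λ c → success (proj₁ c) (proj₂ c)) ⟩
  ∑ cells (λ c → 3 * ∑ Rs (λ r → if ok r c then weight r else 0))
    ≡⟨ ∑-cong cells (λ c → trans (sym (∑-*ˡ Rs 3 _)) (∑-cong Rs (λ r → weighted-indicator 3 (ok r c) (weight r)))) ⟩
  ∑ cells (λ c → ∑ Rs (λ r → weight r * (3 * ⟦ ok r c ⟧)))
    ≡⟨ ∑-swap cells Rs _ ⟩
  ∑ Rs (λ r → ∑ cells (λ c → weight r * (3 * ⟦ ok r c ⟧)))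
    ≡⟨ ∑-cong Rs (λ r → trans (∑-*ˡ cells (weight r) _) (cong (weight r *_) (∑-*ˡ cells 3 _))) ⟩
  ∑ Rs (λ r → weight r * (3 * SingleProtocol.correctCount (Π r))) ∎
  where
  open AMProtocol P
  open Computes computes
  open ≤-Reasoning
  cells : List (Word n × Word n)
  cells = allCells n
  D : ℕ
  D = length cells
  Rs : List (Fin m)
  Rs = allFin m
  ok : Fin m → Word n × Word n → Bool
  ok r = SingleProtocol.correctAt (Π r)

-- The closing estimate: 2k ≤ 3c and c² ≤ p·k with k > 0 give k ≤ 4p
-- (indeed (2k)² ≤ 9c² ≤ 9pk, so 4k ≤ 9p ≤ 16p)
k≤4p : ∀ k c p → 0 < k → 2 * k ≤ 3 * c → c * c ≤ p * k → k ≤ 4 * p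
k≤4p k c p k>0 2k≤3c c²≤pk =
  *-cancelˡ-≤ 4 (≤-trans 4k≤9p (≤-trans (*-monoˡ-≤ p (m≤m+n 9 7)) (≤-reflexive (*-assoc 4 4 p))))
  where
  open ≤-Reasoning
  4k≤9p : 4 * k ≤ 9 * p
  4k≤9p = *-cancelʳ-≤ (4 * k) (9 * p) k {{>-nonZero k>0}} (begin
    4 * k * k         ≡⟨ solve 1 (λ k → con 4 :* k :* k := (con 2 :* k) :* (con 2 :* k)) refl k ⟩
    (2 * k) * (2 * k) ≤⟨ *-mono-≤ 2k≤3c 2k≤3c ⟩
    (3 * c) * (3 * c) ≡⟨ solve 1 (λ c → (con 3 :* c) :* (con 3 :* c) := con 9 :* (c :* c)) refl c ⟩
    9 * (c * c)       ≤⟨ *-monoʳ-≤ 9 c²≤pk ⟩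
    9 * (p * k)       ≡⟨ sym (*-assoc 9 p k) ⟩
    9 * p * k         ∎)

lower-bound : ∀ {n} (P : AMProtocol n) → Computes P xorW →
              2 ^ (2 * n) ≤ 4 * AMProtocol.maxSize P * AMProtocol.ρ P
lower-bound {n} P computes = begin
  2 ^ (2 * n)                         ≡⟨ sym (length-allCells n) ⟩
  D                                   ≤⟨ k≤4p D (C r) (size (Π r) * thickness (Π r)) D>0 2D≤3C (SingleProtocol.correctCount² (Π r)) ⟩
  4 * (size (Π r) * thickness (Π r))  ≡⟨ sym (*-assoc 4 (size (Π r)) (thickness (Π r))) ⟩
  4 * size (Π r) * thickness (Π r)    ≤⟨ *-mono-≤ (*-monoʳ-≤ 4 (≤-maxL (λ r → size (Π r)) (∈-allFin r)))
                                                  (≤-maxL (λ r → thickness (Π r)) (∈-allFin r)) ⟩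
  4 * maxSize * ρ                     ∎
  where
  open AMProtocol P
  open ProtocolWithError using (size; thickness)
  open ≤-Reasoning
  D : ℕ
  D = length (allCells n)
  D>0 : 0 < D
  D>0 = subst (0 <_) (sym (length-allCells n)) (m^n>0 2 (2 * n))
  C : Fin m → ℕ
  C r = SingleProtocol.correctCount (Π r)
  good : ∃[ r ] 2 * D ≤ 3 * C r
  good = averaging m weight (λ r → 3 * C r) (2 * D) (Computes.total-pos computes) (expected-correct P computes)
  r : Fin m
  r = proj₁ good
  2D≤3C : 2 * D ≤ 3 * C r
  2D≤3C = proj₂ good

claim5p1 : ∃[ c ] ∀ (n : ℕ) → 1 ≤ n → (P : AMProtocol n) → Computes P xorW →
    2 ^ (2 * n) ≤ 2 ^ c * AMProtocol.maxSize P * AMProtocol.ρ P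
claim5p1 = 2 , λ n _ → lower-bound
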